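{- Let $a_0,\dots,a_{15}\in\mathbb{Z}$ and let $N_1,N_2,N_4,N_8,N_{16}$ be as in the context. Then $N_1\equiv N_2\equiv N_4\equiv N_8\equiv N_{16}\pmod 2$.
   Context: Let $f(x)=\sum_{k=0}^{15}a_kx^k$ and $\zeta_{16}=e^{2\pi\sqrt{ -1}/16}$. For each divisor $d$ of $16$, $N_d := \prod_{0\le l\le 15,\ \gcd(l,16)=d} f(\zeta_{16}^l)$ (with $\gcd(0,16)=16$); each $N_d$ is an integer. -}

module Defs where

open import Data.Integer using (ℤ; +_; -[1+_]; _+_; _*_; -_; _-_)
open import Data.Nat using (ℕ; _%_; _/_; _≡ᵇ_; _<ᵇ_)
import Data.Nat as ℕ
open import Data.Nat.GCD using (gcd)
open import Data.Fin using (Fin; toℕ; zero)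
open import Data.List using (List; foldr; map; allFin; upTo)
open import Data.Bool using (if_then_else_)

-- The ring of cyclotomic integers ℤ[ζ₁₆] ≅ ℤ[x]/(Φ₁₆(x)), Φ₁₆(x) = x⁸ + 1,
-- with ζ₁₆ ↦ x.  An element is its coefficient vector w.r.t. 1, ζ, …, ζ⁷.
Cyc : Set
Cyc = Fin 8 → ℤ

zeroC : Cyc
zeroC _ = + 0

oneC : Cyc
oneC i = if toℕ i ≡ᵇ 0 then + 1 else + 0

_⊕_ : Cyc → Cyc → Cyc
(p ⊕ q) i = p i + q i

scale : ℤ → Cyc → Cyc
scale c p i = c * p i

sumℤ : List ℤ → ℤ
sumℤ = foldr _+_ (+ 0)

-- multiplication modulo x⁸ + 1 (negacyclic convolution)
_⊗_ : Cyc → Cyc → Cyc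
(p ⊗ q) k = sumℤ (map (λ i → sumℤ (map (λ j → term i j) (allFin 8))) (allFin 8))
  where
  term : Fin 8 → Fin 8 → ℤ
  term i j = if ((toℕ i ℕ.+ toℕ j) % 8) ≡ᵇ toℕ k
             then (if (toℕ i ℕ.+ toℕ j) <ᵇ 8 then p i * q j else - (p i * q j))
             else + 0

-- ζ₁₆ ^ m  =  (-1)^⌊m/8⌋ · x^(m mod 8)
zpow : ℕ → Cyc
zpow m i = if toℕ i ≡ᵇ (m % 8)
           then (if ((m / 8) % 2) ≡ᵇ 0 then + 1 else -[1+ 0 ])
           else + 0

-- f(ζ₁₆^l) where f(x) = Σ_{k=0}^{15} a_k x^k
evalAt : (Fin 16 → ℤ) → ℕ → Cyc
evalAt a l = foldr _⊕_ zeroC (map (λ k → scale (a k) (zpow (l ℕ.* toℕ k))) (allFin 16))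

-- N_d = ∏_{0 ≤ l ≤ 15, gcd(l,16) = d} f(ζ₁₆^l)   (gcd 0 16 = 16), as an element of ℤ[ζ₁₆]
Ncyc : (Fin 16 → ℤ) → ℕ → Cyc
Ncyc a d = foldr _⊗_ oneC
  (map (λ l → if gcd l 16 ≡ᵇ d then evalAt a l else oneC) (upTo 16))

-- N_d is a rational integer (as stated in the context); its integer value is the
-- coefficient of 1 = ζ⁰.
N : (Fin 16 → ℤ) → ℕ → ℤ
N a d = Ncyc a d zero

{-# OPTIONS --safe #-}
module Submission where

open import Defs
open import Data.Integer using (ℤ; +_; _-_)
open import Data.Integer.Divisibility using (_∣_)
open import Data.Fin using (Fin)
open import Data.Product using (_×_)

open import Algebra.Bundles using (CommutativeRing)
open import Algebra.Properties.CommutativeSemigroup using (interchange)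
open import Data.Bool using (Bool; true; false; _xor_; _∧_; if_then_else_)
open import Data.Bool.Properties as Boolₚ
  using (xor-identityʳ; xor-assoc; ∧-distribʳ-xor; xor-∧-commutativeRing)
open import Data.Fin using (zero; suc; toℕ; _↑ˡ_; _↑ʳ_)
open import Data.Fin.Properties using (toℕ-↑ˡ; toℕ-↑ʳ)
open import Data.Integer using (-[1+_]; _+_; _*_; -_; _%ℕ_; _/ℕ_)
open import Data.Integer.DivMod using (a≡a%ℕn+[a/ℕn]*n; n%ℕd<d)
import Data.Integer.Divisibility.Signed as Signed
open Signed using (divides; ∣m∣n⇒∣m+n; ∣m∣n⇒∣m-n; ∣m⇒∣m*n; ∣n⇒∣m*n; ∣⇒∣ᵤ)
open import Data.Integer.Properties using (-1*i≡-i)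
open import Data.Integer.Solver using (module +-*-Solver)
open import Data.List using (List; []; _∷_; _++_; foldr; map; allFin; upTo; filterᵇ)
open import Data.List.Relation.Unary.All as All using (All; []; _∷_)
open import Data.Nat as ℕ using (ℕ; _≡ᵇ_; s≤s)
open import Data.Nat.DivMod using ([m+kn]%n≡m%n)
open import Data.Nat.Divisibility using (∣1⇒≡1)
open import Data.Nat.GCD using (gcd)
open import Data.Nat.Properties using (*-distribˡ-+; +-comm)
open import Data.Product using (_,_)
open import Data.Vec using (Vec; lookup; tabulate)
open import Data.Vec.Properties using (lookup∘tabulate)
import Data.Vec.Functional as Vector
open import Function using (_∘_)
open import Level using (0ℓ)
open import Relation.Binary.PropositionalEquality
open import Relation.Nullary using (Dec; _×-dec_)
open import Relation.Nullary.Decidable using (map′; from-yes)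
open import Relation.Unary using (Pred; Decidable)

-- Modulo 2 the ring ℤ[ζ₁₆] = ℤ[x]/(x⁸ + 1) becomes 𝔽₂[x]/(x⁸ + 1), in which x⁸ = 1.
-- Hence N_d mod 2 depends only on the eight parities of a_k + a_{k+8}, and evaluating
-- all 2⁸ parity vectors shows that every N_d is congruent to f(1) modulo 2.

-- Parity of integers

⟦_⟧ : Bool → ℤ
⟦ true ⟧ = + 1
⟦ false ⟧ = + 0

open Data.Integer.Solver.+-*-Solver using (solve; con; _:+_; _:-_; _:*_; _:=_)

2∣-resp : ∀ {x y} → x ≡ y → + 2 Signed.∣ x → + 2 Signed.∣ y
2∣-resp = subst (+ 2 Signed.∣_)

-- Opaque, so that the type checker compares parities of large symbolic
-- integers by comparing the integers instead of unfolding both.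
opaque
  parity : ℤ → Bool
  parity x = x %ℕ 2 ≡ᵇ 1

  parity-spec : ∀ x → + 2 Signed.∣ x - ⟦ parity x ⟧
  parity-spec x = from-remainder (x %ℕ 2) (n%ℕd<d x 2) (a≡a%ℕn+[a/ℕn]*n x 2)
    where
    cancel-remainder : ∀ {r} → x ≡ + r + (x /ℕ 2) * + 2 → + 2 Signed.∣ x - + r
    cancel-remainder {r} eq = divides (x /ℕ 2)
      (trans (cong (_- + r) eq) (solve 2 (λ r q → (r :+ q) :- r := q) refl (+ r) ((x /ℕ 2) * + 2)))
    from-remainder : ∀ r → r ℕ.< 2 → x ≡ + r + (x /ℕ 2) * + 2 → + 2 Signed.∣ x - ⟦ r ≡ᵇ 1 ⟧
    from-remainder 0 _ eq = cancel-remainder eq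
    from-remainder 1 _ eq = cancel-remainder eq
    from-remainder (ℕ.suc (ℕ.suc _)) (s≤s (s≤s ())) _

2∣⟦⟧-⟦⟧⇒≡ : ∀ {b c} → + 2 Signed.∣ ⟦ b ⟧ - ⟦ c ⟧ → b ≡ c
2∣⟦⟧-⟦⟧⇒≡ {true} {true} _ = refl
2∣⟦⟧-⟦⟧⇒≡ {false} {false} _ = refl
2∣⟦⟧-⟦⟧⇒≡ {true} {false} 2∣1 with () ← ∣1⇒≡1 (∣⇒∣ᵤ 2∣1)
2∣⟦⟧-⟦⟧⇒≡ {false} {true} 2∣-1 with () ← ∣1⇒≡1 (∣⇒∣ᵤ 2∣-1)

parity-unique : ∀ {x b} → + 2 Signed.∣ x - ⟦ b ⟧ → parity x ≡ b
parity-unique {x} {b} 2∣x-b = 2∣⟦⟧-⟦⟧⇒≡ (2∣-resp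
  (solve 3 (λ x p b → (x :- b) :- (x :- p) := p :- b) refl x ⟦ parity x ⟧ ⟦ b ⟧)
  (∣m∣n⇒∣m-n 2∣x-b (parity-spec x)))

parity-≡⇒2∣- : ∀ {x y} → parity x ≡ parity y → + 2 Signed.∣ x - y
parity-≡⇒2∣- {x} {y} eq = 2∣-resp
  (solve 3 (λ x y p → (x :- p) :- (y :- p) := x :- y) refl x y ⟦ parity y ⟧)
  (∣m∣n⇒∣m-n (subst (λ b → + 2 Signed.∣ x - ⟦ b ⟧) eq (parity-spec x)) (parity-spec y))

⟦⟧-xor : ∀ b c → + 2 Signed.∣ (⟦ b ⟧ + ⟦ c ⟧) - ⟦ b xor c ⟧
⟦⟧-xor true true = divides (+ 1) refl
⟦⟧-xor true false = divides (+ 0) refl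
⟦⟧-xor false true = divides (+ 0) refl
⟦⟧-xor false false = divides (+ 0) refl

⟦⟧-∧ : ∀ b c → ⟦ b ∧ c ⟧ ≡ ⟦ b ⟧ * ⟦ c ⟧
⟦⟧-∧ true true = refl
⟦⟧-∧ true false = refl
⟦⟧-∧ false c = refl

parity-+ : ∀ x y → parity (x + y) ≡ parity x xor parity y
parity-+ x y = parity-unique {x + y} (2∣-resp
  (solve 5 (λ x y p q r → ((x :- p) :+ (y :- q)) :+ ((p :+ q) :- r) := (x :+ y) :- r)
     refl x y ⟦ parity x ⟧ ⟦ parity y ⟧ ⟦ parity x xor parity y ⟧)
  (∣m∣n⇒∣m+n (∣m∣n⇒∣m+n (parity-spec x) (parity-spec y)) (⟦⟧-xor (parity x) (parity y))))

parity-* : ∀ x y → parity (x * y) ≡ parity x ∧ parity y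
parity-* x y = parity-unique {x * y} (2∣-resp
  (trans (solve 4 (λ x y p q → ((x :- p) :* y) :+ (p :* (y :- q)) := (x :* y) :- (p :* q))
            refl x y ⟦ parity x ⟧ ⟦ parity y ⟧)
         (cong (λ r → (x * y) - r) (sym (⟦⟧-∧ (parity x) (parity y)))))
  (∣m∣n⇒∣m+n (∣m⇒∣m*n y (parity-spec x)) (∣n⇒∣m*n ⟦ parity x ⟧ (parity-spec y))))

parity-neg : ∀ x → parity (- x) ≡ parity x
parity-neg x = trans (cong parity (sym (-1*i≡-i x)))
  (trans (parity-* -[1+ 0 ] x) (cong (_∧ parity x) (parity-unique (divides -[1+ 0 ] refl))))

parity-⟦⟧ : ∀ b → parity ⟦ b ⟧ ≡ b
parity-⟦⟧ b = parity-unique (divides (+ 0) (solve 1 (λ x → x :- x := con (+ 0) :* con (+ 2)) refl ⟦ b ⟧))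

mod2 : {X : Set} → (X → ℤ) → X → Bool
mod2 p x = parity (p x)

parity-sumℤ : {A : Set} (f : A → ℤ) (xs : List A) →
              parity (sumℤ (map f xs)) ≡ foldr _xor_ false (map (mod2 f) xs)
parity-sumℤ f [] = parity-⟦⟧ false
parity-sumℤ f (x ∷ xs) = trans (parity-+ (f x) _) (cong (parity (f x) xor_) (parity-sumℤ f xs))

-- The ring 𝔽₂[x]/(x⁸ + 1), mirroring the definitions of ℤ[ζ₁₆]

Cyc₂ : Set
Cyc₂ = Fin 8 → Bool

xsum : List Bool → Bool
xsum = foldr _xor_ false

zero₂ : Cyc₂
zero₂ _ = false

one₂ : Cyc₂
one₂ i = toℕ i ≡ᵇ 0

_⊕₂_ : Cyc₂ → Cyc₂ → Cyc₂
(p ⊕₂ q) i = p i xor q i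

scale₂ : Bool → Cyc₂ → Cyc₂
scale₂ c p i = c ∧ p i

_⊗₂_ : Cyc₂ → Cyc₂ → Cyc₂
(p ⊗₂ q) k = xsum (map (λ i → xsum (map (λ j → term i j) (allFin 8))) (allFin 8))
  where
  term : Fin 8 → Fin 8 → Bool
  term i j = if ((toℕ i ℕ.+ toℕ j) ℕ.% 8) ≡ᵇ toℕ k then p i ∧ q j else false

zpow₂ : ℕ → Cyc₂
zpow₂ m i = toℕ i ≡ᵇ (m ℕ.% 8)

monomial₂ : ∀ {n} → (Fin n → Bool) → ℕ → Fin n → Cyc₂
monomial₂ b l k = scale₂ (b k) (zpow₂ (l ℕ.* toℕ k))

eval₂ : ∀ {n} → (Fin n → Bool) → ℕ → Cyc₂
eval₂ {n} b l = foldr _⊕₂_ zero₂ (map (monomial₂ b l) (allFin n))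

factor₂ : ∀ {n} → (Fin n → Bool) → ℕ → ℕ → Cyc₂
factor₂ b d l = if gcd l 16 ≡ᵇ d then eval₂ b l else one₂

N₂ : ∀ {n} → (Fin n → Bool) → ℕ → Cyc₂
N₂ b d = foldr _⊗₂_ one₂ (map (factor₂ b d) (upTo 16))

foldr-map-preserves : {A B X : Set} (R : A → B → Set) {_•_ : A → A → A} {_◦_ : B → B → B}
  {e : A} {e′ : B} {f : X → A} {g : X → B} →
  (∀ {w x y z} → R w x → R y z → R (w • y) (x ◦ z)) → R e e′ → (∀ x → R (f x) (g x)) →
  ∀ xs → R (foldr _•_ e (map f xs)) (foldr _◦_ e′ (map g xs))
foldr-map-preserves R pres e~e′ f~g [] = e~e′
foldr-map-preserves R pres e~e′ f~g (x ∷ xs) = pres (f~g x) (foldr-map-preserves R pres e~e′ f~g xs)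

if-preserves : {A B : Set} (R : A → B → Set) (c : Bool) {x y : A} {x′ y′ : B} →
               R x x′ → R y y′ → R (if c then x else y) (if c then x′ else y′)
if-preserves R true x~x′ _ = x~x′
if-preserves R false _ y~y′ = y~y′

xsum-cong : {A : Set} {f g : A → Bool} → f ≗ g → ∀ xs → xsum (map f xs) ≡ xsum (map g xs)
xsum-cong f≗g = foldr-map-preserves _≡_ (cong₂ _xor_) refl f≗g

xsum-xor : {A : Set} (f g : A → Bool) (xs : List A) →
  xsum (map (λ x → f x xor g x) xs) ≡ xsum (map f xs) xor xsum (map g xs)
xsum-xor f g [] = refl
xsum-xor f g (x ∷ xs) = trans (cong ((f x xor g x) xor_) (xsum-xor f g xs))
  (interchange +-commutativeSemigroup (f x) (g x) _ _)
  where open CommutativeRing xor-∧-commutativeRing using (+-commutativeSemigroup)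

xsum-++ : ∀ xs ys → xsum (xs ++ ys) ≡ xsum xs xor xsum ys
xsum-++ [] ys = refl
xsum-++ (x ∷ xs) ys = trans (cong (x xor_) (xsum-++ xs ys)) (sym (xor-assoc x (xsum xs) (xsum ys)))

⊗₂-cong : ∀ {p p′ q q′} → p ≗ p′ → q ≗ q′ → p ⊗₂ q ≗ p′ ⊗₂ q′
⊗₂-cong p≗p′ q≗q′ k = xsum-cong (λ i → xsum-cong (λ j →
  cong (λ z → if ((toℕ i ℕ.+ toℕ j) ℕ.% 8) ≡ᵇ toℕ k then z else false) (cong₂ _∧_ (p≗p′ i) (q≗q′ j)))
  (allFin 8)) (allFin 8)

⊗₂-identityˡ : ∀ r → one₂ ⊗₂ r ≗ r
⊗₂-identityˡ r zero = trans (xor-identityʳ _) (xor-identityʳ _)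
⊗₂-identityˡ r (suc zero) = trans (xor-identityʳ _) (xor-identityʳ _)
⊗₂-identityˡ r (suc (suc zero)) = trans (xor-identityʳ _) (xor-identityʳ _)
⊗₂-identityˡ r (suc (suc (suc zero))) = trans (xor-identityʳ _) (xor-identityʳ _)
⊗₂-identityˡ r (suc (suc (suc (suc zero)))) = trans (xor-identityʳ _) (xor-identityʳ _)
⊗₂-identityˡ r (suc (suc (suc (suc (suc zero))))) = trans (xor-identityʳ _) (xor-identityʳ _)
⊗₂-identityˡ r (suc (suc (suc (suc (suc (suc zero)))))) = trans (xor-identityʳ _) (xor-identityʳ _)
⊗₂-identityˡ r (suc (suc (suc (suc (suc (suc (suc zero))))))) = trans (xor-identityʳ _) (xor-identityʳ _)

eval₂-cong : ∀ {n} {b c : Fin n → Bool} → b ≗ c → ∀ l → eval₂ b l ≗ eval₂ c l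
eval₂-cong {b = b} {c} b≗c l = foldr-map-preserves _≗_ {_⊕₂_} {_⊕₂_} {zero₂} {zero₂}
  {monomial₂ b l} {monomial₂ c l} (λ p≗p′ q≗q′ i → cong₂ _xor_ (p≗p′ i) (q≗q′ i))
  (λ _ → refl) (λ k i → cong (_∧ zpow₂ (l ℕ.* toℕ k) i) (b≗c k)) (allFin _)

product₂-cong : {X : Set} {F G : X → Cyc₂} → (∀ x → F x ≗ G x) →
  ∀ xs → foldr _⊗₂_ one₂ (map F xs) ≗ foldr _⊗₂_ one₂ (map G xs)
product₂-cong {F = F} {G} =
  foldr-map-preserves _≗_ {_⊗₂_} {_⊗₂_} {one₂} {one₂} {F} {G} ⊗₂-cong (λ _ → refl)

N₂-cong : ∀ {n} {b c : Fin n → Bool} → b ≗ c → ∀ d → N₂ b d ≗ N₂ c d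
N₂-cong {b = b} {c} b≗c d = product₂-cong {F = factor₂ b d} {factor₂ c d}
  (λ l → if-preserves _≗_ (gcd l 16 ≡ᵇ d) (eval₂-cong b≗c l) (λ _ → refl)) (upTo 16)

-- Reduction modulo 2

parity-signed : ∀ c c′ z → parity (if c then (if c′ then z else - z) else + 0) ≡ (if c then parity z else false)
parity-signed true true z = refl
parity-signed true false z = parity-neg z
parity-signed false c′ z = parity-⟦⟧ false

mod2-⊗ : ∀ p q → mod2 (p ⊗ q) ≗ mod2 p ⊗₂ mod2 q
mod2-⊗ p q k = trans (parity-sumℤ row (allFin 8))
  (xsum-cong (λ i → trans (parity-sumℤ (term i) (allFin 8)) (xsum-cong (parity-term i) (allFin 8))) (allFin 8))
  where
  hit : Fin 8 → Fin 8 → Bool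
  hit i j = ((toℕ i ℕ.+ toℕ j) ℕ.% 8) ≡ᵇ toℕ k
  term : Fin 8 → Fin 8 → ℤ
  term i j = if hit i j then (if (toℕ i ℕ.+ toℕ j) ℕ.<ᵇ 8 then p i * q j else - (p i * q j)) else + 0
  row : Fin 8 → ℤ
  row i = sumℤ (map (term i) (allFin 8))
  parity-term : ∀ i j → parity (term i j) ≡ (if hit i j then parity (p i) ∧ parity (q j) else false)
  parity-term i j = trans (parity-signed (hit i j) _ (p i * q j))
                          (cong (λ b → if hit i j then b else false) (parity-* (p i) (q j)))

-- A record rather than `mod2 p ≗ P`, so that the type checker compares elements
-- of ℤ[ζ₁₆] as wholes instead of unfolding their coefficients.
record _↦₂_ (p : Cyc) (P : Cyc₂) : Set where
  constructor reduces
  field coefficientwise : mod2 p ≗ P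
open _↦₂_

↦₂-⊕ : ∀ {p P q Q} → p ↦₂ P → q ↦₂ Q → (p ⊕ q) ↦₂ (P ⊕₂ Q)
↦₂-⊕ {p} {P} {q} {Q} (reduces p↦P) (reduces q↦Q) =
  reduces λ i → trans (parity-+ (p i) (q i)) (cong₂ _xor_ (p↦P i) (q↦Q i))

↦₂-⊗ : ∀ {p P q Q} → p ↦₂ P → q ↦₂ Q → (p ⊗ q) ↦₂ (P ⊗₂ Q)
↦₂-⊗ {p} {P} {q} {Q} (reduces p↦P) (reduces q↦Q) =
  reduces λ k → trans (mod2-⊗ p q k) (⊗₂-cong {mod2 p} {P} {mod2 q} {Q} p↦P q↦Q k)

↦₂-zero : zeroC ↦₂ zero₂
↦₂-zero = reduces λ _ → parity-⟦⟧ false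

↦₂-one : oneC ↦₂ one₂
↦₂-one = reduces λ i → parity-one (toℕ i ≡ᵇ 0)
  where
  parity-one : ∀ c → parity (if c then + 1 else + 0) ≡ c
  parity-one true = parity-⟦⟧ true
  parity-one false = parity-⟦⟧ false

↦₂-monomial : ∀ {n} (a : Fin n → ℤ) l k → scale (a k) (zpow (l ℕ.* toℕ k)) ↦₂ monomial₂ (mod2 a) l k
↦₂-monomial a l k = reduces λ i → trans (parity-* (a k) _) (cong (parity (a k) ∧_) (parity-zpow i))
  where
  parity-zpow : ∀ i → parity (zpow (l ℕ.* toℕ k) i) ≡ zpow₂ (l ℕ.* toℕ k) i
  parity-zpow i with toℕ i ≡ᵇ ((l ℕ.* toℕ k) ℕ.% 8) | ((l ℕ.* toℕ k) ℕ./ 8) ℕ.% 2 ≡ᵇ 0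
  ... | true | true = parity-⟦⟧ true
  ... | true | false = trans (parity-neg (+ 1)) (parity-⟦⟧ true)
  ... | false | _ = parity-⟦⟧ false

↦₂-evalAt : ∀ a l → evalAt a l ↦₂ eval₂ (mod2 a) l
↦₂-evalAt a l = foldr-map-preserves _↦₂_ {_⊕_} {_⊕₂_} {zeroC} {zero₂}
  {λ k → scale (a k) (zpow (l ℕ.* toℕ k))} {monomial₂ (mod2 a) l}
  ↦₂-⊕ ↦₂-zero (↦₂-monomial a l) (allFin 16)

↦₂-Ncyc : ∀ a d → Ncyc a d ↦₂ N₂ (mod2 a) d
↦₂-Ncyc a d = foldr-map-preserves _↦₂_ {_⊗_} {_⊗₂_} {oneC} {one₂}
  {λ l → if gcd l 16 ≡ᵇ d then evalAt a l else oneC} {factor₂ (mod2 a) d}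
  ↦₂-⊗ ↦₂-one (λ l → if-preserves _↦₂_ (gcd l 16 ≡ᵇ d) (↦₂-evalAt a l) ↦₂-one) (upTo 16)

-- Folding sixteen coefficients into eight, since x⁸ = 1 in 𝔽₂[x]/(x⁸ + 1)

fold : (Fin 16 → Bool) → Fin 8 → Bool
fold b j = b (j ↑ˡ 8) xor b (8 ↑ʳ j)

eval₂-coefficient : ∀ {n} (b : Fin n → Bool) l i →
  eval₂ b l i ≡ xsum (map (λ k → b k ∧ zpow₂ (l ℕ.* toℕ k) i) (allFin n))
eval₂-coefficient b l i = go (allFin _)
  where
  go : ∀ ks → foldr _⊕₂_ zero₂ (map (monomial₂ b l) ks) i
              ≡ xsum (map (λ k → b k ∧ zpow₂ (l ℕ.* toℕ k) i) ks)
  go [] = refl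
  go (k ∷ ks) = cong ((b k ∧ zpow₂ (l ℕ.* toℕ k) i) xor_) (go ks)

zpow₂-periodic : ∀ l t → zpow₂ (l ℕ.* (8 ℕ.+ t)) ≡ zpow₂ (l ℕ.* t)
zpow₂-periodic l t = cong (λ r i → toℕ i ≡ᵇ r) (trans
  (cong (ℕ._% 8) (trans (*-distribˡ-+ l 8 t) (+-comm (l ℕ.* 8) (l ℕ.* t))))
  ([m+kn]%n≡m%n (l ℕ.* t) l 8))

eval₂-fold : ∀ b l → eval₂ b l ≗ eval₂ (fold b) l
eval₂-fold b l i = begin
  eval₂ b l i                                             ≡⟨ eval₂-coefficient b l i ⟩
  xsum (map (λ k → b k ∧ z (toℕ k)) (allFin 16))          ≡⟨ xsum-++ (map low (allFin 8)) (map high (allFin 8)) ⟩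
  xsum (map low (allFin 8)) xor xsum (map high (allFin 8)) ≡⟨ sym (xsum-xor low high (allFin 8)) ⟩
  xsum (map (λ j → low j xor high j) (allFin 8))          ≡⟨ xsum-cong halves (allFin 8) ⟩
  xsum (map (λ j → fold b j ∧ z (toℕ j)) (allFin 8))      ≡⟨ sym (eval₂-coefficient (fold b) l i) ⟩
  eval₂ (fold b) l i                                      ∎
  where
  open ≡-Reasoning
  z : ℕ → Bool
  z t = zpow₂ (l ℕ.* t) i
  low high : Fin 8 → Bool
  low j = b (j ↑ˡ 8) ∧ z (toℕ (j ↑ˡ 8))
  high j = b (8 ↑ʳ j) ∧ z (toℕ (8 ↑ʳ j))
  halves : ∀ j → low j xor high j ≡ fold b j ∧ z (toℕ j)
  halves j = begin
    low j xor high j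
      ≡⟨ cong₂ (λ s t → (b (j ↑ˡ 8) ∧ s) xor (b (8 ↑ʳ j) ∧ t))
           (cong z (toℕ-↑ˡ j 8)) (trans (cong z (toℕ-↑ʳ 8 j)) (cong-app (zpow₂-periodic l (toℕ j)) i)) ⟩
    (b (j ↑ˡ 8) ∧ z (toℕ j)) xor (b (8 ↑ʳ j) ∧ z (toℕ j))
      ≡⟨ sym (∧-distribʳ-xor (z (toℕ j)) (b (j ↑ˡ 8)) (b (8 ↑ʳ j))) ⟩
    fold b j ∧ z (toℕ j) ∎

N₂-fold : ∀ b d → N₂ b d ≗ N₂ (fold b) d
N₂-fold b d = product₂-cong {F = factor₂ b d} {factor₂ (fold b) d}
  (λ l → if-preserves _≗_ (gcd l 16 ≡ᵇ d) (eval₂-fold b l) (λ _ → refl)) (upTo 16)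

-- Agda's evaluator does not share subterms, so a product is computed in
-- continuation-passing style, forcing every coefficient to a literal before reuse.
withForced : {A : Set} → ∀ n → (Fin n → Bool) → ((Fin n → Bool) → A) → A
withForced ℕ.zero p k = k p
withForced (ℕ.suc n) p k =
  if p zero then withForced n (p ∘ suc) (k ∘ (true Vector.∷_))
            else withForced n (p ∘ suc) (k ∘ (false Vector.∷_))

Respects≗ : {A : Set} {n : ℕ} → ((Fin n → Bool) → A) → Set
Respects≗ k = ∀ p q → p ≗ q → k p ≡ k q

withForced-correct : {A : Set} → ∀ n p (k : (Fin n → Bool) → A) → Respects≗ k → withForced n p k ≡ k p
withForced-correct ℕ.zero p k _ = refl
withForced-correct (ℕ.suc n) p k resp =
  trans (branch (p zero))
        (trans (withForced-correct n (p ∘ suc) (k ∘ (p zero Vector.∷_))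
                  (λ q q′ q≗q′ → resp (p zero Vector.∷ q) (p zero Vector.∷ q′) (∷-cong q≗q′)))
               (resp (p zero Vector.∷ (p ∘ suc)) p head∷tail))
  where
  continue : Bool → _
  continue b = withForced n (p ∘ suc) (k ∘ (b Vector.∷_))
  branch : ∀ b → (if b then continue true else continue false) ≡ continue b
  branch true = refl
  branch false = refl
  ∷-cong : ∀ {q q′ : Fin n → Bool} → q ≗ q′ → (p zero Vector.∷ q) ≗ (p zero Vector.∷ q′)
  ∷-cong q≗q′ zero = refl
  ∷-cong q≗q′ (suc i) = q≗q′ i
  head∷tail : (p zero Vector.∷ (p ∘ suc)) ≗ p
  head∷tail zero = refl
  head∷tail (suc i) = refl

productK : {A : Set} → List Cyc₂ → (Cyc₂ → A) → A
productK [] k = k one₂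
productK (x ∷ xs) k = productK xs (λ r → withForced 8 x (λ x′ → withForced 8 (x′ ⊗₂ r) k))

productK-correct : {A : Set} (xs : List Cyc₂) (k : Cyc₂ → A) → Respects≗ k →
                   productK xs k ≡ k (foldr _⊗₂_ one₂ xs)
productK-correct [] k _ = refl
productK-correct (x ∷ xs) k resp =
  trans (productK-correct xs step step-resp) (multiply (foldr _⊗₂_ one₂ xs))
  where
  multiply-forced : ∀ r x′ → withForced 8 (x′ ⊗₂ r) k ≡ k (x′ ⊗₂ r)
  multiply-forced r x′ = withForced-correct 8 (x′ ⊗₂ r) k resp
  step : Cyc₂ → _
  step r = withForced 8 x (λ x′ → withForced 8 (x′ ⊗₂ r) k)
  multiply : ∀ r → step r ≡ k (x ⊗₂ r)
  multiply r = trans (withForced-correct 8 x (λ x′ → withForced 8 (x′ ⊗₂ r) k) resp′) (multiply-forced r x)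
    where
    resp′ : Respects≗ (λ x′ → withForced 8 (x′ ⊗₂ r) k)
    resp′ p q p≗q = trans (multiply-forced r p)
      (trans (resp (p ⊗₂ r) (q ⊗₂ r) (⊗₂-cong {p} {q} {r} {r} p≗q (λ _ → refl))) (sym (multiply-forced r q)))
  step-resp : Respects≗ step
  step-resp r r′ r≗r′ = trans (multiply r)
    (trans (resp (x ⊗₂ r) (x ⊗₂ r′) (⊗₂-cong {x} {x} {r} {r′} (λ _ → refl) r≗r′)) (sym (multiply r′)))

product-filter : ∀ {n} (b : Fin n → Bool) d ls →
  foldr _⊗₂_ one₂ (map (factor₂ b d) ls) ≗ foldr _⊗₂_ one₂ (map (eval₂ b) (filterᵇ (λ l → gcd l 16 ≡ᵇ d) ls))
product-filter b d [] _ = refl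
product-filter b d (l ∷ ls) with gcd l 16 ≡ᵇ d
... | true = ⊗₂-cong {eval₂ b l} {eval₂ b l} {foldr _⊗₂_ one₂ (map (factor₂ b d) ls)}
               (λ _ → refl) (product-filter b d ls)
... | false = λ i → trans (⊗₂-identityˡ (foldr _⊗₂_ one₂ (map (factor₂ b d) ls)) i) (product-filter b d ls i)

gcd-class : ℕ → List ℕ
gcd-class d = filterᵇ (λ l → gcd l 16 ≡ᵇ d) (upTo 16)

fastN : (Fin 8 → Bool) → ℕ → Bool
fastN b d = productK (map (eval₂ b) (gcd-class d)) (λ p → p zero)

fastN-correct : ∀ b d → fastN b d ≡ N₂ b d zero
fastN-correct b d = trans (productK-correct (map (eval₂ b) (gcd-class d)) (λ p → p zero) (λ _ _ p≗q → p≗q zero))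
                          (sym (product-filter b d (upTo 16) zero))

all-vectors? : ∀ {n} {P : Pred (Vec Bool n) 0ℓ} → Decidable P → Dec (∀ v → P v)
all-vectors? {ℕ.zero} P? = map′ (λ { p Data.Vec.[] → p }) (λ h → h Data.Vec.[]) (P? Data.Vec.[])
all-vectors? {ℕ.suc n} P? =
  map′ (λ { (t , f) (true Data.Vec.∷ v) → t v ; (t , f) (false Data.Vec.∷ v) → f v })
       (λ h → (λ v → h (true Data.Vec.∷ v)) , (λ v → h (false Data.Vec.∷ v)))
       (all-vectors? (P? ∘ (true Data.Vec.∷_)) ×-dec all-vectors? (P? ∘ (false Data.Vec.∷_)))

value-at-1 : ∀ {n} → (Fin n → Bool) → Bool
value-at-1 b = xsum (map b (allFin _))

fastN≡value-at-1 : ∀ v → All (λ d → fastN (lookup v) d ≡ value-at-1 (lookup v)) (1 ∷ 2 ∷ 4 ∷ 8 ∷ 16 ∷ [])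
fastN≡value-at-1 = from-yes (all-vectors? (λ v →
  All.all? (λ d → fastN (lookup v) d Boolₚ.≟ value-at-1 (lookup v)) (1 ∷ 2 ∷ 4 ∷ 8 ∷ 16 ∷ [])))


folded-parities : (Fin 16 → ℤ) → Vec Bool 8
folded-parities a = tabulate (fold (mod2 a))

parity-N : ∀ a d → parity (N a d) ≡ fastN (lookup (folded-parities a)) d
parity-N a d = begin
  mod2 (Ncyc a d) zero                      ≡⟨ coefficientwise (↦₂-Ncyc a d) zero ⟩
  N₂ (mod2 a) d zero                        ≡⟨ N₂-fold (mod2 a) d zero ⟩
  N₂ (fold (mod2 a)) d zero                 ≡⟨ N₂-cong {b = fold (mod2 a)} {lookup v} tabulated d zero ⟩
  N₂ (lookup v) d zero                      ≡⟨ sym (fastN-correct (lookup v) d) ⟩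
  fastN (lookup v) d                        ∎
  where
  open ≡-Reasoning
  v : Vec Bool 8
  v = folded-parities a
  tabulated : fold (mod2 a) ≗ lookup v
  tabulated j = sym (lookup∘tabulate (fold (mod2 a)) j)

lemma3p2 : (a : Fin 16 → ℤ) →
    ((+ 2) ∣ (N a 1 - N a 2)) × ((+ 2) ∣ (N a 2 - N a 4)) ×
    ((+ 2) ∣ (N a 4 - N a 8)) × ((+ 2) ∣ (N a 8 - N a 16))
lemma3p2 a = from-checked (fastN≡value-at-1 (folded-parities a))
  where
  s : Bool
  s = value-at-1 (lookup (folded-parities a))
  congruent : ∀ d d′ → fastN (lookup (folded-parities a)) d ≡ s → fastN (lookup (folded-parities a)) d′ ≡ s →
              (+ 2) ∣ (N a d - N a d′)
  congruent d d′ e e′ =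
    ∣⇒∣ᵤ (parity-≡⇒2∣- (trans (trans (parity-N a d) e) (sym (trans (parity-N a d′) e′))))
  from-checked : All (λ d → fastN (lookup (folded-parities a)) d ≡ s) (1 ∷ 2 ∷ 4 ∷ 8 ∷ 16 ∷ []) →
    ((+ 2) ∣ (N a 1 - N a 2)) × ((+ 2) ∣ (N a 2 - N a 4)) ×
    ((+ 2) ∣ (N a 4 - N a 8)) × ((+ 2) ∣ (N a 8 - N a 16))
  from-checked (e₁ ∷ e₂ ∷ e₄ ∷ e₈ ∷ e₁₆ ∷ []) =
    congruent 1 2 e₁ e₂ , congruent 2 4 e₂ e₄ , congruent 4 8 e₄ e₈ , congruent 8 16 e₈ e₁₆
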